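{- For every integer $n\ge 3$, the squid graph $Sq(2n-1;1^n)$ is nice.
   Context: The squid graph $Sq(2n-1;1^n)$ is obtained from the cycle $C_{2n-1}$ on vertices $u,u_1,\ldots,u_{2n-2}$ (in cyclic order) by attaching $n$ leaves $v_1,\ldots,v_n$ to the vertex $u$. A stable partition of a graph $G$ is a set partition of $V(G)$ into stable (independent) sets; its type is the partition formed by the block sizes in weakly decreasing order. For partitions of the same integer, $\mu\le\lambda$ in dominance order means $\sum_{i=1}^k\mu_i\le\sum_{i=1}^k\lambda_i$ for all $k$. A graph $G$ is nice if for any partitions $\mu\le\lambda$ in dominance order, whenever $G$ has a stable partition of type $\lambda$, it also has a stable partition of type $\mu$. -}

module Defs where

open import Data.Nat using (ℕ; zero; suc; _+_; _*_; _∸_; _≤_; _<_; _≥_)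
open import Data.Fin using (Fin; toℕ; _≟_)
open import Data.List using (List; []; _∷_; map; filter; length; take; allFin)
open import Data.Nat.ListAction using (sum)
open import Data.List.Relation.Unary.All using (All)
open import Data.List.Relation.Binary.Permutation.Propositional using (_↭_)
open import Data.List.Relation.Unary.Linked using (Linked)
open import Data.Product using (Σ; _×_; ∃)
open import Data.Sum using (_⊎_)
open import Relation.Binary.PropositionalEquality using (_≡_)
open import Relation.Nullary using (¬_)

record Graph : Set₁ where
  field
    size : ℕ
    Adj  : Fin size → Fin size → Set
open Graph public

IsPartition : ℕ → List ℕ → Set
IsPartition N λs = Linked _≥_ λs × All (λ p → 1 ≤ p) λs × sum λs ≡ N

_⊴_ : List ℕ → List ℕ → Set
μ ⊴ λs = ∀ k → sum (take k μ) ≤ sum (take k λs)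

-- A stable partition of G into k labelled blocks, encoded by the block map
-- c : V → Fin k; the blocks are the fibres of c. Stability: adjacent vertices
-- lie in different blocks.
IsStableMap : (G : Graph) {k : ℕ} → (Fin (size G) → Fin k) → Set
IsStableMap G c = ∀ x y → Adj G x y → ¬ (c x ≡ c y)

blockSizes : {N k : ℕ} → (Fin N → Fin k) → List ℕ
blockSizes {N} {k} c = map (λ j → length (filter (λ v → c v ≟ j) (allFin N))) (allFin k)

-- G has a stable partition of type λ: there is a stable partition whose
-- multiset of block sizes equals the parts of λ (so all blocks are nonempty
-- when λ has positive parts).
HasStablePartitionOfType : Graph → List ℕ → Set
HasStablePartitionOfType G λs =
  ∃ λ k → Σ (Fin (size G) → Fin k) λ c → IsStableMap G c × (blockSizes c ↭ λs)

Nice : Graph → Set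
Nice G = ∀ μ λs → IsPartition (size G) μ → IsPartition (size G) λs →
         μ ⊴ λs → HasStablePartitionOfType G λs → HasStablePartitionOfType G μ

-- The squid graph Sq(2n-1; 1^n), on vertices 0 .. 3n-2:
--   0 = u, i = u_i for 1 ≤ i ≤ 2n-2 (the cycle C_{2n-1} is 0,1,...,2n-2 in order),
--   2n-1+j = v_{j+1} for 0 ≤ j < n (leaves attached to u = 0).
CycEdge : ℕ → ℕ → ℕ → Set
CycEdge m i j = i < m × j < m × (suc i ≡ j ⊎ (suc i ≡ m × j ≡ 0))

LeafEdge : ℕ → ℕ → ℕ → ℕ → Set
LeafEdge m total i j = i ≡ 0 × m ≤ j × j < total

SqAdjℕ : ℕ → ℕ → ℕ → Set
SqAdjℕ n i j =
  CycEdge m i j ⊎ CycEdge m j i ⊎ LeafEdge m total i j ⊎ LeafEdge m total j i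
  where
    m = 2 * n ∸ 1
    total = 3 * n ∸ 1

Squid : ℕ → Graph
Squid n = record { size = 3 * n ∸ 1 ; Adj = λ x y → SqAdjℕ n (toℕ x) (toℕ y) }

-- Write n = a + 1, so that the squid has 3a + 2 vertices, and let λ be the type of a stable
-- partition.  The 2a + 1 cliques {u_{2t+1}, u_{2t+2}} (t < a), {u, v_1}, {v_2}, …, {v_n} cover
-- the vertices, so every block has at most 2n − 1 elements; and the odd cycle forces at least
-- three blocks.  Hence λ₁ ≤ 2n − 1 and λ₁ + λ₂ < 3a + 2, and both conditions pass to every
-- μ ⊴ λ.  Conversely, for such a μ, list the vertices as
--   u_1, u_3, …, u_{2a−1}, v_1, …, v_n, u_{2a}, u_{2a−2}, …, u_2, u
-- and cut the list into consecutive intervals of lengths μ₁ ≥ μ₂ ≥ ⋯.  The positions p < q of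
-- the ends of any edge satisfy q ≥ 2a + 1, q − p ≥ a, and q is the last position or p < a.
-- As μ₁ ≤ 2a + 1, μ₁ + μ₂ ≤ 3a + 1 and μ₃ ≤ a, no interval contains both ends of an edge.

module Submission where

open import Defs
open import Data.Bool.Base using (Bool; true; false)
open import Data.Fin as Fin using (Fin; toℕ; fromℕ<)
open import Data.Fin.Patterns using (0F; 1F)
open import Data.Fin.Permutation using (Permutation; _⟨$⟩ʳ_)
open import Data.Fin.Properties
  using (toℕ-injective; toℕ<n; toℕ≤pred[n]; toℕ-fromℕ; toℕ-fromℕ<; toℕ-inject₁;
         inject≤-injective; opposite-involutive; injective⇒≤)
open import Data.List.Base using (List; []; _∷_; map; filter; length; lookup; take; tabulate; allFin)
open import Data.List.Properties using (map-cong; map-tabulate; tabulate-lookup; length-map; length-tabulate)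
open import Data.List.Membership.Propositional.Properties using (∈-lookup; ∈-filter⁻)
open import Data.List.Relation.Binary.Permutation.Propositional using (↭-reflexive)
open import Data.List.Relation.Binary.Permutation.Propositional.Properties using (All-resp-↭; ↭-length)
open import Data.List.Relation.Unary.All as All using (All; []; _∷_)
import Data.List.Relation.Unary.All.Properties as Allₚ
open import Data.List.Relation.Unary.AllPairs using (_∷_)
open import Data.List.Relation.Unary.Linked using (_∷_)
open import Data.List.Relation.Unary.Linked.Properties using (Linked⇒All)
open import Data.List.Relation.Unary.Unique.Propositional using (Unique)
open import Data.List.Relation.Unary.Unique.Propositional.Properties using (allFin⁺; filter⁺)
import Data.Nat as ℕ
open import Data.Nat.Base using (ℕ; zero; suc; _+_; _*_; _∸_; _≤_; _<_; z≤n; s≤s; z<s; s<s; s≤s⁻¹)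
open import Data.Nat.ListAction using (sum)
open import Data.Nat.Properties
open import Algebra.Properties.CommutativeMonoid.Sum +-0-commutativeMonoid
  using (sum-cong-≗; ∑-permute) renaming (sum to ∑)
open import Data.Product.Base using (∃; _×_; _,_; proj₁; proj₂)
open import Data.Sum.Base using (_⊎_; inj₁; inj₂; swap)
open import Function.Base using (_∘_; id)
open import Function.Bundles using (Inverse; _↔_; _⇔_; mk⇔; mk⤖)
open import Function.Definitions using (Injective)
open import Function.Properties.Bijection using (⤖⇒↔)
open import Function.Properties.Inverse using (↔-sym; ↔-trans)
open import Relation.Binary.PropositionalEquality
open import Relation.Nullary.Decidable using (does; does-⇔; yes; no)
open import Relation.Nullary.Negation using (¬_; contradiction)
open import Relation.Unary using (Pred; Decidable)

-- Counting fibres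

indicator : Bool → ℕ
indicator true  = 1
indicator false = 0

length-filter-tabulate : ∀ {A : Set} {p} {P : Pred A p} (P? : Decidable P) {n} (g : Fin n → A) →
                         length (filter P? (tabulate g)) ≡ ∑ (λ i → indicator (does (P? (g i))))
length-filter-tabulate P? {zero}  g = refl
length-filter-tabulate P? {suc n} g with does (P? (g Fin.zero))
... | true  = cong suc (length-filter-tabulate P? (g ∘ Fin.suc))
... | false = length-filter-tabulate P? (g ∘ Fin.suc)

blockSizes-permute : ∀ {N k} (c : Fin N → Fin k) (π : Permutation N N) →
                     blockSizes (c ∘ (π ⟨$⟩ʳ_)) ≡ blockSizes c
blockSizes-permute {N} c π = map-cong fibre _
  where
  open ≡-Reasoning
  fibre : ∀ j → length (filter (λ v → c (π ⟨$⟩ʳ v) Fin.≟ j) (allFin N))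
              ≡ length (filter (λ v → c v Fin.≟ j) (allFin N))
  fibre j = begin
    length (filter (λ v → c (π ⟨$⟩ʳ v) Fin.≟ j) (allFin N))
      ≡⟨ length-filter-tabulate (λ v → c (π ⟨$⟩ʳ v) Fin.≟ j) id ⟩
    ∑ (λ v → indicator (does (c (π ⟨$⟩ʳ v) Fin.≟ j)))
      ≡⟨ ∑-permute (λ v → indicator (does (c v Fin.≟ j))) π ⟨
    ∑ (λ v → indicator (does (c v Fin.≟ j)))
      ≡⟨ length-filter-tabulate (λ v → c v Fin.≟ j) id ⟨
    length (filter (λ v → c v Fin.≟ j) (allFin N))
      ∎

count : (ℕ → Bool) → ℕ → ℕ
count f zero    = 0
count f (suc n) = indicator (f 0) + count (f ∘ suc) n

∑-indicator-toℕ : ∀ n (f : ℕ → Bool) → ∑ {n} (λ i → indicator (f (toℕ i))) ≡ count f n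
∑-indicator-toℕ zero    f = refl
∑-indicator-toℕ (suc n) f = cong (indicator (f 0) +_) (∑-indicator-toℕ n (f ∘ suc))

count-+ : ∀ m n f → count f (m + n) ≡ count f m + count (f ∘ (m +_)) n
count-+ zero    n f = refl
count-+ (suc m) n f = trans (cong (indicator (f 0) +_) (count-+ m n (f ∘ suc)))
                            (sym (+-assoc (indicator (f 0)) _ _))

count-cong : ∀ n {f g : ℕ → Bool} → (∀ p → f p ≡ g p) → count f n ≡ count g n
count-cong zero    f≗g = refl
count-cong (suc n) f≗g = cong₂ _+_ (cong indicator (f≗g 0)) (count-cong n (f≗g ∘ suc))

count-true : ∀ n f → (∀ {p} → p < n → f p ≡ true) → count f n ≡ n
count-true zero    f all = refl
count-true (suc n) f all rewrite all z<s = cong suc (count-true n (f ∘ suc) (all ∘ s<s))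

count-false : ∀ n f → (∀ {p} → p < n → f p ≡ false) → count f n ≡ 0
count-false zero    f none = refl
count-false (suc n) f none rewrite none z<s = count-false n (f ∘ suc) (none ∘ s<s)

-- Consecutive intervals

-- The index of the interval containing p when 0, 1, 2, … is cut into intervals of lengths μ.
chunk : List ℕ → ℕ → ℕ
chunk []          p       = 0
chunk (zero  ∷ μ) p       = suc (chunk μ p)
chunk (suc m ∷ μ) zero    = 0
chunk (suc m ∷ μ) (suc p) = chunk (m ∷ μ) p

chunk-< : ∀ {m p} μ → p < m → chunk (m ∷ μ) p ≡ 0
chunk-< {suc m} {zero}  μ _         = refl
chunk-< {suc m} {suc p} μ (s<s p<m) = chunk-< μ p<m

chunk-+ : ∀ m μ p → chunk (m ∷ μ) (m + p) ≡ suc (chunk μ p)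
chunk-+ zero    μ p = refl
chunk-+ (suc m) μ p = chunk-+ m μ p

chunk-+-injective : ∀ m μ {p q} → chunk (m ∷ μ) (m + p) ≡ chunk (m ∷ μ) (m + q) →
                    chunk μ p ≡ chunk μ q
chunk-+-injective m μ {p} {q} same rewrite chunk-+ m μ p | chunk-+ m μ q = suc-injective same

chunk-<-+ : ∀ m μ {p q} → p < m → chunk (m ∷ μ) p ≢ chunk (m ∷ μ) (m + q)
chunk-<-+ m μ {p} {q} p<m rewrite chunk-< μ p<m | chunk-+ m μ q = 0≢1+n

data Split (m : ℕ) : ℕ → Set where
  below : ∀ {p} → p < m → Split m p
  above : ∀ p → Split m (m + p)

split : ∀ m p → Split m p
split zero    p       = above p
split (suc m) zero    = below z<s
split (suc m) (suc p) with split m p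
... | below p<m = below (s<s p<m)
... | above q   = above q

chunk<length : ∀ μ {p} → p < sum μ → chunk μ p < length μ
chunk<length (m ∷ μ) {p} p<sum with split m p
... | below p<m rewrite chunk-< μ p<m = z<s
... | above q   rewrite chunk-+ m μ q = s<s (chunk<length μ (+-cancelˡ-< m _ _ p<sum))

count-chunk : ∀ μ (j : Fin (length μ)) →
              count (λ p → does (chunk μ p ℕ.≟ toℕ j)) (sum μ) ≡ lookup μ j
count-chunk (m ∷ μ) j = trans (count-+ m (sum μ) _) (parts j)
  where
  parts : ∀ j → count (λ p → does (chunk (m ∷ μ) p ℕ.≟ toℕ j)) m
              + count (λ p → does (chunk (m ∷ μ) (m + p) ℕ.≟ toℕ j)) (sum μ) ≡ lookup (m ∷ μ) j
  parts Fin.zero = trans (cong₂ _+_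
    (count-true m _ (λ p<m → cong (λ c → does (c ℕ.≟ 0)) (chunk-< μ p<m)))
    (count-false (sum μ) _ (λ {p} _ → cong (λ c → does (c ℕ.≟ 0)) (chunk-+ m μ p))))
    (+-identityʳ m)
  parts (Fin.suc j) = cong₂ _+_
    (count-false m _ (λ p<m → cong (λ c → does (c ℕ.≟ suc (toℕ j))) (chunk-< μ p<m)))
    (trans (count-cong (sum μ) (λ p → cong (λ c → does (c ℕ.≟ suc (toℕ j))) (chunk-+ m μ p)))
           (count-chunk μ j))

chunkMap : ∀ {N} μ → sum μ ≡ N → Fin N → Fin (length μ)
chunkMap μ refl v = fromℕ< (chunk<length μ (toℕ<n v))

toℕ-chunkMap : ∀ {N} μ (e : sum μ ≡ N) v → toℕ (chunkMap μ e v) ≡ chunk μ (toℕ v)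
toℕ-chunkMap μ refl v = toℕ-fromℕ< (chunk<length μ (toℕ<n v))

blockSizes-chunkMap : ∀ {N} μ (e : sum μ ≡ N) → blockSizes (chunkMap μ e) ≡ μ
blockSizes-chunkMap μ refl = begin
  map fibre (allFin (length μ))      ≡⟨ map-cong fibre≡part (allFin (length μ)) ⟩
  map (lookup μ) (allFin (length μ)) ≡⟨ map-tabulate id (lookup μ) ⟩
  tabulate (lookup μ)                ≡⟨ tabulate-lookup μ ⟩
  μ                                  ∎
  where
  open ≡-Reasoning
  fibre : Fin (length μ) → ℕ
  fibre j = length (filter (λ v → chunkMap μ refl v Fin.≟ j) (allFin (sum μ)))
  fibre≡part : ∀ j → fibre j ≡ lookup μ j
  fibre≡part j = begin
    fibre j
      ≡⟨ length-filter-tabulate (λ v → chunkMap μ refl v Fin.≟ j) id ⟩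
    ∑ {sum μ} (λ v → indicator (does (chunkMap μ refl v Fin.≟ j)))
      ≡⟨ sum-cong-≗ (λ v → cong indicator
           (does-⇔ (same-index v) (chunkMap μ refl v Fin.≟ j) (chunk μ (toℕ v) ℕ.≟ toℕ j))) ⟩
    ∑ {sum μ} (λ v → indicator (does (chunk μ (toℕ v) ℕ.≟ toℕ j)))
      ≡⟨ ∑-indicator-toℕ (sum μ) (λ p → does (chunk μ p ℕ.≟ toℕ j)) ⟩
    count (λ p → does (chunk μ p ℕ.≟ toℕ j)) (sum μ)
      ≡⟨ count-chunk μ j ⟩
    lookup μ j
      ∎
    where
    same-index : ∀ v → (chunkMap μ refl v ≡ j) ⇔ (chunk μ (toℕ v) ≡ toℕ j)
    same-index v = mk⇔ (λ eq → trans (sym (toℕ-chunkMap μ refl v)) (cong toℕ eq))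
                       (λ eq → toℕ-injective (trans (toℕ-chunkMap μ refl v) eq))

chunk-gap : ∀ {B} μ {p q} → All (_≤ B) μ → p ≤ q → q < sum μ →
            chunk μ p ≡ chunk μ q → q < p + B
chunk-gap {B} (m ∷ μ) {p} {q} (m≤B ∷ μ≤B) p≤q q<sum same with split m p | split m q
... | below p<m | below q<m = <-≤-trans q<m (≤-trans m≤B (m≤n+m B p))
... | below p<m | above q′  = contradiction same (chunk-<-+ m μ p<m)
... | above p′  | below q<m = contradiction (sym same) (chunk-<-+ m μ q<m)
... | above p′  | above q′  = subst (m + q′ <_) (sym (+-assoc m p′ B))
  (+-monoʳ-< m (chunk-gap μ μ≤B (+-cancelˡ-≤ m p′ q′ p≤q) (+-cancelˡ-< m q′ (sum μ) q<sum)
                          (chunk-+-injective m μ same)))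

-- Separating the ends of an edge

2*a≡a+a : ∀ a → 2 * a ≡ a + a
2*a≡a+a a = cong (a +_) (+-identityʳ a)

3*a≡2*a+a : ∀ a → 3 * a ≡ 2 * a + a
3*a≡2*a+a a = +-comm a (2 * a)

2*a≤3*a : ∀ a → 2 * a ≤ 3 * a
2*a≤3*a a = *-monoˡ-≤ a (n≤1+n 2)

+-assoc-cancelˡ-≤ : ∀ m {x y a} → m + x + a ≤ m + y → x + a ≤ y
+-assoc-cancelˡ-≤ m {x} {y} {a} le = +-cancelˡ-≤ m (x + a) y (subst (_≤ m + y) (+-assoc m x a) le)

third-part≤ : ∀ {a m₁ m₂ m₃} r → m₂ ≤ m₁ → m₃ ≤ m₂ →
              m₁ + (m₂ + (m₃ + r)) ≡ suc (suc (3 * a)) → m₃ ≤ a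
third-part≤ {a} {m₁} {m₂} {m₃} r m₂≤m₁ m₃≤m₂ total = ≮⇒≥ λ a<m₃ → <-irrefl refl (begin-strict
  suc (suc (3 * a))        <⟨ n<1+n _ ⟩
  suc (suc (suc (3 * a)))  ≡⟨ *-suc 3 a ⟨
  3 * suc a                ≤⟨ *-monoʳ-≤ 3 a<m₃ ⟩
  m₃ + (m₃ + (m₃ + 0))     ≤⟨ +-mono-≤ (≤-trans m₃≤m₂ m₂≤m₁) (+-mono-≤ m₃≤m₂ (+-monoʳ-≤ m₃ z≤n)) ⟩
  m₁ + (m₂ + (m₃ + r))     ≡⟨ total ⟩
  suc (suc (3 * a))        ∎)
  where open ≤-Reasoning

-- The positions of the two ends of an edge in the order of the header, the earlier one first.
Apart : ℕ → ℕ → ℕ → Set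
Apart a p q = suc (2 * a) ≤ q × p + a ≤ q × (q ≡ suc (3 * a) ⊎ p < a)

chunk-apart : ∀ {a m₁ m₂ m₃ rest p q} → IsPartition (suc (suc (3 * a))) (m₁ ∷ m₂ ∷ m₃ ∷ rest) →
              m₁ ≤ suc (2 * a) → Apart a p q → q < suc (suc (3 * a)) →
              chunk (m₁ ∷ m₂ ∷ m₃ ∷ rest) p ≢ chunk (m₁ ∷ m₂ ∷ m₃ ∷ rest) q
chunk-apart {a} {m₁} {m₂} {m₃} {rest} {p} {q} (m₂≤m₁ ∷ m₃≤m₂ ∷ tail-sorted , _ ∷ _ ∷ 1≤m₃ ∷ _ , total)
            m₁≤ (far , p+a≤q , last-or-early) q<N
  with split m₁ p | split m₁ q
... | _          | below q<m₁ = λ _ → <⇒≱ q<m₁ (≤-trans m₁≤ far)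
... | below p<m₁ | above q′   = chunk-<-+ m₁ _ p<m₁
... | above p′   | above q′   = second-or-later ∘ chunk-+-injective m₁ _
  where
  second-part : q′ < m₂ → ¬ (m₁ + q′ ≡ suc (3 * a) ⊎ m₁ + p′ < a)
  second-part q′<m₂ (inj₁ q≡last) = <-irrefl refl (begin-strict
    suc (suc (3 * a))             ≡⟨ cong suc q≡last ⟨
    suc (m₁ + q′)                 ≤⟨ +-monoʳ-< m₁ q′<m₂ ⟩
    m₁ + m₂                       <⟨ +-monoʳ-< m₁ (m<m+n m₂ (≤-trans 1≤m₃ (m≤m+n m₃ (sum rest)))) ⟩
    m₁ + (m₂ + (m₃ + sum rest))   ≡⟨ total ⟩
    suc (suc (3 * a))             ∎)
    where open ≤-Reasoning
  second-part q′<m₂ (inj₂ p<a) = <-irrefl refl (begin-strict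
    a         ≤⟨ m≤n+m a p′ ⟩
    p′ + a    ≤⟨ +-assoc-cancelˡ-≤ m₁ p+a≤q ⟩
    q′        <⟨ q′<m₂ ⟩
    m₂        ≤⟨ m₂≤m₁ ⟩
    m₁        ≤⟨ m≤m+n m₁ p′ ⟩
    m₁ + p′   <⟨ p<a ⟩
    a         ∎)
    where open ≤-Reasoning

  second-or-later : chunk (m₂ ∷ m₃ ∷ rest) p′ ≢ chunk (m₂ ∷ m₃ ∷ rest) q′
  second-or-later same with split m₂ p′ | split m₂ q′
  ... | below p′<m₂ | above q″    = chunk-<-+ m₂ _ p′<m₂ same
  ... | above p″    | below q′<m₂ = chunk-<-+ m₂ _ q′<m₂ (sym same)
  ... | below p′<m₂ | below q′<m₂ = second-part q′<m₂ last-or-early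
  ... | above p″    | above q″    = <-irrefl refl (begin-strict
    q″        <⟨ chunk-gap (m₃ ∷ rest) tail≤m₃ p″≤q″ q″<rest (chunk-+-injective m₂ _ same) ⟩
    p″ + m₃   ≤⟨ +-monoʳ-≤ p″ (third-part≤ (sum rest) m₂≤m₁ m₃≤m₂ total) ⟩
    p″ + a    ≤⟨ p″+a≤q″ ⟩
    q″        ∎)
    where
    open ≤-Reasoning
    p″+a≤q″ : p″ + a ≤ q″
    p″+a≤q″ = +-assoc-cancelˡ-≤ m₂ (+-assoc-cancelˡ-≤ m₁ p+a≤q)
    p″≤q″ : p″ ≤ q″
    p″≤q″ = ≤-trans (m≤m+n p″ a) p″+a≤q″
    q″<rest : q″ < m₃ + sum rest
    q″<rest = +-cancelˡ-< m₂ _ _ (+-cancelˡ-< m₁ _ _ (subst (m₁ + (m₂ + q″) <_) (sym total) q<N))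
    tail≤m₃ : All (_≤ m₃) (m₃ ∷ rest)
    tail≤m₃ = Linked⇒All (λ x≥y y≥z → ≤-trans y≥z x≥y) ≤-refl tail-sorted

-- Graphs, colourings and enumerations

lookup-injective : ∀ {A : Set} {xs : List A} → Unique xs →
                   ∀ {i j} → lookup xs i ≡ lookup xs j → i ≡ j
lookup-injective (_  ∷ _)   {Fin.zero}  {Fin.zero}  _  = refl
lookup-injective (x∉ ∷ _)   {Fin.zero}  {Fin.suc j} eq = contradiction eq (All.lookup x∉ (∈-lookup j))
lookup-injective (x∉ ∷ _)   {Fin.suc i} {Fin.zero}  eq = contradiction (sym eq) (All.lookup x∉ (∈-lookup i))
lookup-injective (_  ∷ xs!) {Fin.suc i} {Fin.suc j} eq = cong Fin.suc (lookup-injective xs! eq)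

fibre≤cliques : ∀ (G : Graph) {m k} (clique : Fin (size G) → Fin m) →
                (∀ x y → clique x ≡ clique y → x ≡ y ⊎ Adj G x y) →
                (c : Fin (size G) → Fin k) → IsStableMap G c →
                ∀ j → length (filter (λ v → c v Fin.≟ j) (allFin (size G))) ≤ m
fibre≤cliques G clique cover c stable j = injective⇒≤ clique-injective
  where
  block : List (Fin (size G))
  block = filter (λ v → c v Fin.≟ j) (allFin (size G))
  in-block : ∀ i → c (lookup block i) ≡ j
  in-block i = proj₂ (∈-filter⁻ (λ v → c v Fin.≟ j) {xs = allFin (size G)} (∈-lookup i))
  clique-injective : Injective _≡_ _≡_ (clique ∘ lookup block)
  clique-injective {i} {i′} eq with cover _ _ eq
  ... | inj₁ same = lookup-injective (filter⁺ _ (allFin⁺ (size G))) same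
  ... | inj₂ adj  = contradiction (trans (in-block i) (sym (in-block i′))) (stable _ _ adj)

Fin2-≢-≢ : {x y z : Fin 2} → x ≢ y → y ≢ z → x ≡ z
Fin2-≢-≢ {0F} {0F} {_}  x≢y _   = contradiction refl x≢y
Fin2-≢-≢ {1F} {1F} {_}  x≢y _   = contradiction refl x≢y
Fin2-≢-≢ {_}  {0F} {0F} _   y≢z = contradiction refl y≢z
Fin2-≢-≢ {_}  {1F} {1F} _   y≢z = contradiction refl y≢z
Fin2-≢-≢ {0F} {1F} {0F} _   _   = refl
Fin2-≢-≢ {1F} {0F} {1F} _   _   = refl

chain-constant : ∀ {A : Set} n (g : Fin (suc n) → A) → (∀ t → g (Fin.inject₁ t) ≡ g (Fin.suc t)) →
                 g (Fin.fromℕ n) ≡ g Fin.zero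
chain-constant zero    g step = refl
chain-constant (suc n) g step =
  trans (sym (step (Fin.fromℕ n))) (chain-constant n (g ∘ Fin.inject₁) (step ∘ Fin.inject₁))

stable-inject≤ : ∀ (G : Graph) {k m} (c : Fin (size G) → Fin k) (k≤m : k ≤ m) →
                 IsStableMap G c → IsStableMap G (λ v → Fin.inject≤ (c v) k≤m)
stable-inject≤ G c k≤m stable x y adj eq = stable x y adj (inject≤-injective k≤m k≤m (c x) (c y) eq)

colours≥3 : ∀ (G : Graph) → (∀ (c : Fin (size G) → Fin 2) → ¬ IsStableMap G c) →
            ∀ {k} (c : Fin (size G) → Fin k) → IsStableMap G c → 3 ≤ k
colours≥3 G not-bipartite {k} c stable with 3 ≤? k
... | yes 3≤k = 3≤k
... | no  3≰k = contradiction (stable-inject≤ G c (s≤s⁻¹ (≰⇒> 3≰k)) stable) (not-bipartite _)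

take2<sum : ∀ {xs} → 3 ≤ length xs → All (1 ≤_) xs → sum (take 2 xs) < sum xs
take2<sum {_ ∷ []}         (s≤s ())       _
take2<sum {_ ∷ _ ∷ []}     (s≤s (s≤s ())) _
take2<sum {x ∷ y ∷ z ∷ zs} _              (_ ∷ _ ∷ 1≤z ∷ _) =
  +-monoʳ-< x (subst (_< y + (z + sum zs)) (sym (+-identityʳ y))
                     (m<m+n y (≤-trans 1≤z (m≤m+n z (sum zs)))))

module Enumeration {A : Set} {N : ℕ} (e : A → ℕ) (e<N : ∀ x → e x < N)
                   (e-injective : ∀ {x y} → e x ≡ e y → x ≡ y)
                   (e-onto : ∀ i → i < N → ∃ λ x → e x ≡ i) where

  enumeration : A ↔ Fin N
  enumeration = ⤖⇒↔ (mk⤖ (injective , surjective))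
    where
    injective : ∀ {x y} → fromℕ< (e<N x) ≡ fromℕ< (e<N y) → x ≡ y
    injective eq = e-injective (trans (sym (toℕ-fromℕ< _)) (trans (cong toℕ eq) (toℕ-fromℕ< _)))
    surjective : ∀ i → ∃ λ x → ∀ {z} → z ≡ x → fromℕ< (e<N z) ≡ i
    surjective i with x , ex ← e-onto (toℕ i) (toℕ<n i) =
      x , λ { refl → toℕ-injective (trans (toℕ-fromℕ< _) ex) }

  toℕ-enumeration : ∀ x → toℕ (Inverse.to enumeration x) ≡ e x
  toℕ-enumeration x = toℕ-fromℕ< (e<N x)

  enumeration-from : ∀ i → e (Inverse.from enumeration i) ≡ toℕ i
  enumeration-from i = trans (sym (toℕ-enumeration _)) (cong toℕ (Inverse.strictlyInverseˡ enumeration i))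

-- The squid

-- odd t, even t and leaf j stand for u_{2t+1}, u_{2t} and v_{j+1}; in particular u = even 0.
data Slot (a : ℕ) : Set where
  odd  : Fin a → Slot a
  even : Fin (suc a) → Slot a
  leaf : Fin (suc a) → Slot a

vertex : ∀ {a} → Slot a → ℕ
vertex     (odd t)  = suc (2 * toℕ t)
vertex     (even t) = 2 * toℕ t
vertex {a} (leaf j) = suc (2 * a + toℕ j)

position : ∀ {a} → Slot a → ℕ
position     (odd t)  = toℕ t
position {a} (even t) = suc (2 * a + toℕ (Fin.opposite t))
position {a} (leaf j) = a + toℕ j

squid-size : ∀ a → size (Squid (suc a)) ≡ suc (suc (3 * a))
squid-size a = cong (_∸ 1) (*-suc 3 a)

cycle-length : ∀ a → 2 * suc a ∸ 1 ≡ suc (2 * a)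
cycle-length a = cong (_∸ 1) (*-suc 2 a)

vertex-odd< : ∀ {a} (t : Fin a) → vertex (odd t) < suc (2 * a)
vertex-odd< t = s<s (*-monoʳ-< 2 (toℕ<n t))

vertex-even≤ : ∀ {a} (t : Fin (suc a)) → vertex (even t) ≤ 2 * a
vertex-even≤ t = *-monoʳ-≤ 2 (toℕ≤pred[n] t)

vertex-leaf≥ : ∀ {a} (j : Fin (suc a)) → suc (2 * a) ≤ vertex (leaf j)
vertex-leaf≥ j = s≤s (m≤m+n _ _)

+-toℕ≤ : ∀ {a} b (j : Fin (suc a)) → b + toℕ j ≤ b + a
+-toℕ≤ b j = +-monoʳ-≤ b (toℕ≤pred[n] j)

2*a+toℕ≤3*a : ∀ {a} (j : Fin (suc a)) → 2 * a + toℕ j ≤ 3 * a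
2*a+toℕ≤3*a {a} j = subst (2 * a + toℕ j ≤_) (sym (3*a≡2*a+a a)) (+-toℕ≤ (2 * a) j)

position-leaf≤ : ∀ {a} (j : Fin (suc a)) → position (leaf j) ≤ 2 * a
position-leaf≤ {a} j = subst (a + toℕ j ≤_) (sym (2*a≡a+a a)) (+-toℕ≤ a j)

position-even> : ∀ {a} (t : Fin (suc a)) → 2 * a < position (even t)
position-even> t = s≤s (m≤m+n _ _)

position-odd<leaf : ∀ {a} (t : Fin a) (j : Fin (suc a)) → position (odd t) < position (leaf j)
position-odd<leaf {a} t j = <-≤-trans (toℕ<n t) (m≤m+n a _)

position-leaf<even : ∀ {a} (j e : Fin (suc a)) → position (leaf j) < position (even e)
position-leaf<even j e = ≤-<-trans (position-leaf≤ j) (position-even> e)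

position-odd<even : ∀ {a} (t : Fin a) (e : Fin (suc a)) → position (odd t) < position (even e)
position-odd<even t e = <-trans (position-odd<leaf t Fin.zero) (position-leaf<even Fin.zero e)

vertex-odd<leaf : ∀ {a} (t : Fin a) (j : Fin (suc a)) → vertex (odd t) < vertex (leaf j)
vertex-odd<leaf t j = <-≤-trans (vertex-odd< t) (vertex-leaf≥ j)

vertex-even<leaf : ∀ {a} (t j : Fin (suc a)) → vertex (even t) < vertex (leaf j)
vertex-even<leaf t j = ≤-<-trans (vertex-even≤ t) (vertex-leaf≥ j)

vertex<N : ∀ {a} (s : Slot a) → vertex s < suc (suc (3 * a))
vertex<N {a} (odd t)  = <-trans (vertex-odd< t) (s≤s (s≤s (2*a≤3*a a)))
vertex<N {a} (even t) = s≤s (≤-trans (vertex-even≤ t) (≤-trans (2*a≤3*a a) (n≤1+n _)))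
vertex<N     (leaf j) = s≤s (s≤s (2*a+toℕ≤3*a j))

position<N : ∀ {a} (s : Slot a) → position s < suc (suc (3 * a))
position<N {a} (odd t)  = <-≤-trans (toℕ<n t) (≤-trans (m≤m+n a (2 * a)) (m≤n⇒m≤1+n (n≤1+n _)))
position<N {a} (even t) = s≤s (s≤s (2*a+toℕ≤3*a (Fin.opposite t)))
position<N {a} (leaf j) = s≤s (≤-trans (position-leaf≤ j) (≤-trans (2*a≤3*a a) (n≤1+n _)))

offset<1+a : ∀ {a j} → suc (2 * a) + j < suc (suc (3 * a)) → j < suc a
offset<1+a {a} {j} lt =
  s≤s (+-cancelˡ-≤ (2 * a) j a (subst (2 * a + j ≤_) (3*a≡2*a+a a) (s≤s⁻¹ (s≤s⁻¹ lt))))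

vertex-injective : ∀ {a} {s s′ : Slot a} → vertex s ≡ vertex s′ → s ≡ s′
vertex-injective {s = odd t}  {odd t′}  eq = cong odd (toℕ-injective (*-cancelˡ-≡ _ _ 2 (suc-injective eq)))
vertex-injective {s = even t} {even t′} eq = cong even (toℕ-injective (*-cancelˡ-≡ _ _ 2 eq))
vertex-injective {a} {leaf j} {leaf j′} eq =
  cong leaf (toℕ-injective (+-cancelˡ-≡ (2 * a) _ _ (suc-injective eq)))
vertex-injective {s = odd t}  {even t′} eq = contradiction (sym eq) (even≢odd (toℕ t′) (toℕ t))
vertex-injective {s = even t} {odd t′}  eq = contradiction eq (even≢odd (toℕ t) (toℕ t′))
vertex-injective {s = odd t}  {leaf j}  eq = contradiction eq (<⇒≢ (vertex-odd<leaf t j))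
vertex-injective {s = leaf j} {odd t}   eq = contradiction (sym eq) (<⇒≢ (vertex-odd<leaf t j))
vertex-injective {s = even t} {leaf j}  eq = contradiction eq (<⇒≢ (vertex-even<leaf t j))
vertex-injective {s = leaf j} {even t}  eq = contradiction (sym eq) (<⇒≢ (vertex-even<leaf t j))

data ParityView : ℕ → Set where
  even-form : ∀ t → ParityView (2 * t)
  odd-form  : ∀ t → ParityView (suc (2 * t))

parityView : ∀ n → ParityView n
parityView zero = even-form 0
parityView (suc n) with parityView n
... | even-form t = odd-form t
... | odd-form t  = subst ParityView (*-suc 2 t) (even-form (suc t))

vertex-surjective : ∀ a i → i < suc (suc (3 * a)) → ∃ λ (s : Slot a) → vertex s ≡ i
vertex-surjective a i i<N with split (suc (2 * a)) i
... | above j = leaf (fromℕ< (offset<1+a i<N)) ,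
                cong (λ x → suc (2 * a + x)) (toℕ-fromℕ< (offset<1+a i<N))
... | below i≤2a with parityView i
...   | even-form t = even (fromℕ< t<1+a) , cong (2 *_) (toℕ-fromℕ< t<1+a)
  where
  t<1+a : t < suc a
  t<1+a = s≤s (*-cancelˡ-≤ 2 (s≤s⁻¹ i≤2a))
...   | odd-form t = odd (fromℕ< t<a) , cong (λ x → suc (2 * x)) (toℕ-fromℕ< t<a)
  where
  t<a : t < a
  t<a = *-cancelˡ-< 2 t a (s≤s⁻¹ i≤2a)

opposite-injective : ∀ {n} {i j : Fin n} → Fin.opposite i ≡ Fin.opposite j → i ≡ j
opposite-injective {i = i} {j} eq =
  trans (sym (opposite-involutive i)) (trans (cong Fin.opposite eq) (opposite-involutive j))

position-injective : ∀ {a} {s s′ : Slot a} → position s ≡ position s′ → s ≡ s′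
position-injective {s = odd t}  {odd t′}  eq = cong odd (toℕ-injective eq)
position-injective {a} {leaf j} {leaf j′} eq = cong leaf (toℕ-injective (+-cancelˡ-≡ a _ _ eq))
position-injective {a} {even t} {even t′} eq =
  cong even (opposite-injective (toℕ-injective (+-cancelˡ-≡ (2 * a) _ _ (suc-injective eq))))
position-injective {s = odd t}  {leaf j}  eq = contradiction eq (<⇒≢ (position-odd<leaf t j))
position-injective {s = leaf j} {odd t}   eq = contradiction (sym eq) (<⇒≢ (position-odd<leaf t j))
position-injective {s = leaf j} {even e}  eq = contradiction eq (<⇒≢ (position-leaf<even j e))
position-injective {s = even e} {leaf j}  eq = contradiction (sym eq) (<⇒≢ (position-leaf<even j e))
position-injective {s = odd t}  {even e}  eq = contradiction eq (<⇒≢ (position-odd<even t e))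
position-injective {s = even e} {odd t}   eq = contradiction (sym eq) (<⇒≢ (position-odd<even t e))

position-surjective : ∀ a q → q < suc (suc (3 * a)) → ∃ λ (s : Slot a) → position s ≡ q
position-surjective a q q<N with split (suc (2 * a)) q
... | above r = even (Fin.opposite (fromℕ< (offset<1+a q<N))) , cong (λ x → suc (2 * a + x))
                  (trans (cong toℕ (opposite-involutive _)) (toℕ-fromℕ< (offset<1+a q<N)))
... | below q≤2a with split a q
...   | below q<a = odd (fromℕ< q<a) , toℕ-fromℕ< q<a
...   | above r   = leaf (fromℕ< r<1+a) , cong (a +_) (toℕ-fromℕ< r<1+a)
  where
  r<1+a : r < suc a
  r<1+a = s≤s (+-cancelˡ-≤ a r a (subst (a + r ≤_) (2*a≡a+a a) (s≤s⁻¹ q≤2a)))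

SqAdj-sym : ∀ {n i j} → SqAdjℕ n i j → SqAdjℕ n j i
SqAdj-sym (inj₁ e)               = inj₂ (inj₁ e)
SqAdj-sym (inj₂ (inj₁ e))        = inj₁ e
SqAdj-sym (inj₂ (inj₂ (inj₁ e))) = inj₂ (inj₂ (inj₂ e))
SqAdj-sym (inj₂ (inj₂ (inj₂ e))) = inj₂ (inj₂ (inj₁ e))

SqArc : ℕ → ℕ → ℕ → Set
SqArc a i j = CycEdge (2 * suc a ∸ 1) i j ⊎ LeafEdge (2 * suc a ∸ 1) (3 * suc a ∸ 1) i j

SqAdj⇒arc : ∀ {a i j} → SqAdjℕ (suc a) i j → SqArc a i j ⊎ SqArc a j i
SqAdj⇒arc (inj₁ e)               = inj₁ (inj₁ e)
SqAdj⇒arc (inj₂ (inj₁ e))        = inj₂ (inj₁ e)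
SqAdj⇒arc (inj₂ (inj₂ (inj₁ e))) = inj₁ (inj₂ e)
SqAdj⇒arc (inj₂ (inj₂ (inj₂ e))) = inj₂ (inj₂ e)

adj-step : ∀ {a i} → suc i < suc (2 * a) → SqAdjℕ (suc a) i (suc i)
adj-step {a} {i} lt = inj₁ (on-cycle (<-trans (n<1+n i) lt) , on-cycle lt , inj₁ refl)
  where
  on-cycle : ∀ {j} → j < suc (2 * a) → j < 2 * suc a ∸ 1
  on-cycle {j} = subst (j <_) (sym (cycle-length a))

adj-odd-even : ∀ {a} (t : Fin a) → SqAdjℕ (suc a) (vertex (odd t)) (vertex (even (Fin.suc t)))
adj-odd-even {a} t = subst (SqAdjℕ (suc a) (vertex (odd t))) (sym (*-suc 2 (toℕ t)))
  (adj-step (s≤s (subst (_≤ 2 * a) (*-suc 2 (toℕ t)) (*-monoʳ-≤ 2 (toℕ<n t)))))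

adj-even-odd : ∀ {a} (t : Fin a) → SqAdjℕ (suc a) (vertex (even (Fin.inject₁ t))) (vertex (odd t))
adj-even-odd {a} t = subst (λ i → SqAdjℕ (suc a) i (vertex (odd t))) (cong (2 *_) (sym (toℕ-inject₁ t)))
  (adj-step (vertex-odd< t))

adj-wrap : ∀ {a} → SqAdjℕ (suc a) (vertex (even (Fin.fromℕ a))) (vertex {a} (even Fin.zero))
adj-wrap {a} = subst (λ i → SqAdjℕ (suc a) i 0) (cong (2 *_) (sym (toℕ-fromℕ a)))
  (inj₁ (subst (2 * a <_) (sym (cycle-length a)) (n<1+n _) , subst (0 <_) (sym (cycle-length a)) z<s ,
         inj₂ (sym (cycle-length a) , refl)))

adj-u-leaf : ∀ {a} (j : Fin (suc a)) → SqAdjℕ (suc a) (vertex {a} (even Fin.zero)) (vertex (leaf j))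
adj-u-leaf {a} j = inj₂ (inj₂ (inj₁ (refl ,
  subst (_≤ vertex (leaf j)) (sym (cycle-length a)) (vertex-leaf≥ j) ,
  subst (vertex (leaf j) <_) (sym (squid-size a)) (vertex<N (leaf j)))))

position-u : ∀ {a} → position {a} (even Fin.zero) ≡ suc (3 * a)
position-u {a} = cong suc (trans (cong (2 * a +_) (toℕ-fromℕ a)) (sym (3*a≡2*a+a a)))

position-u₂ₐ : ∀ {a} → position (even (Fin.fromℕ a)) ≡ suc (2 * a)
position-u₂ₐ {a} = cong suc (trans (cong (λ i → 2 * a + toℕ i) (opposite-involutive {suc a} Fin.zero))
                                   (+-identityʳ (2 * a)))

apart-odd-even : ∀ {a} (t : Fin a) (e : Fin (suc a)) → Apart a (position (odd t)) (position (even e))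
apart-odd-even {a} t e = position-even> e , t+a≤ , inj₂ (toℕ<n t)
  where
  t+a≤ : toℕ t + a ≤ position (even e)
  t+a≤ = ≤-trans (+-monoˡ-≤ a (<⇒≤ (toℕ<n t)))
                 (≤-trans (≤-reflexive (sym (2*a≡a+a a))) (<⇒≤ (position-even> e)))

apart-u : ∀ {a p} → p + a ≤ suc (3 * a) → Apart a p (position {a} (even Fin.zero))
apart-u {a} {p} p+a≤ =
  position-even> {a} Fin.zero , subst (p + a ≤_) (sym (position-u {a})) p+a≤ , inj₁ (position-u {a})

leaf-off-cycle : ∀ {a} (j : Fin (suc a)) → ¬ vertex (leaf j) < 2 * suc a ∸ 1
leaf-off-cycle {a} j lt = <⇒≱ (subst (vertex (leaf j) <_) (cycle-length a) lt) (vertex-leaf≥ j)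

cycle-off-leaves : ∀ {a} (s : Slot a) → vertex s < suc (2 * a) → ¬ 2 * suc a ∸ 1 ≤ vertex s
cycle-off-leaves {a} s lt ge = <⇒≱ lt (subst (_≤ vertex s) (cycle-length a) ge)

arc-apart : ∀ {a} (s s′ : Slot a) → SqArc a (vertex s) (vertex s′) →
            Apart a (position s) (position s′) ⊎ Apart a (position s′) (position s)
arc-apart (odd t)  (even e)  (inj₁ (_ , _ , inj₁ _))    = inj₁ (apart-odd-even t e)
arc-apart (even e) (odd t)   (inj₁ (_ , _ , inj₁ _))    = inj₂ (apart-odd-even t e)
arc-apart (odd t)  (odd t′)  (inj₁ (_ , _ , inj₁ step)) =
  contradiction (sym (suc-injective step)) (even≢odd (toℕ t′) (toℕ t))
arc-apart (even e) (even e′) (inj₁ (_ , _ , inj₁ step)) =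
  contradiction (sym step) (even≢odd (toℕ e′) (toℕ e))
arc-apart (leaf j) _         (inj₁ (j<m , _ , _))       = contradiction j<m (leaf-off-cycle j)
arc-apart _        (leaf j)  (inj₁ (_ , j<m , _))       = contradiction j<m (leaf-off-cycle j)
arc-apart {a} s s′ (inj₁ (_ , _ , inj₂ (wraps , ends-at-u)))
  with vertex-injective {s = s} {even (Fin.fromℕ a)} s≡u₂ₐ
     | vertex-injective {s = s′} {even Fin.zero} ends-at-u
  where
  s≡u₂ₐ : vertex s ≡ 2 * toℕ (Fin.fromℕ a)
  s≡u₂ₐ = trans (suc-injective (trans wraps (cycle-length a))) (cong (2 *_) (sym (toℕ-fromℕ a)))
... | refl | refl =
  inj₁ (apart-u (≤-reflexive (trans (cong (_+ a) (position-u₂ₐ {a})) (cong suc (sym (3*a≡2*a+a a))))))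
arc-apart {a} s s′ (inj₂ (starts-at-u , _ , _)) with vertex-injective {s = s} {even Fin.zero} starts-at-u
arc-apart {a} _ (leaf j) _ | refl =
  inj₂ (apart-u (≤-trans (+-monoˡ-≤ a (position-leaf≤ j))
                          (≤-trans (≤-reflexive (sym (3*a≡2*a+a a))) (n≤1+n _))))
arc-apart _ (odd t)  (inj₂ (_ , m≤t , _)) | refl =
  contradiction m≤t (cycle-off-leaves (odd t) (vertex-odd< t))
arc-apart _ (even e) (inj₂ (_ , m≤e , _)) | refl =
  contradiction m≤e (cycle-off-leaves (even e) (s≤s (vertex-even≤ e)))

edge-apart : ∀ {a} (s s′ : Slot a) → SqAdjℕ (suc a) (vertex s) (vertex s′) →
             Apart a (position s) (position s′) ⊎ Apart a (position s′) (position s)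
edge-apart s s′ adj with SqAdj⇒arc adj
... | inj₁ arc = arc-apart s s′ arc
... | inj₂ arc = swap (arc-apart s′ s arc)

-- The fibres of matched are the cliques of the header.
matched : ∀ {a} → Slot a → Slot a
matched (odd t)            = odd t
matched (even Fin.zero)    = leaf Fin.zero
matched (even (Fin.suc t)) = odd t
matched (leaf j)           = leaf j

matched-collision : ∀ {a} (s s′ : Slot a) → matched s ≡ matched s′ →
                    s ≡ s′ ⊎ SqAdjℕ (suc a) (vertex s) (vertex s′)
matched-collision     (odd t)            (odd .t)            refl = inj₁ refl
matched-collision     (odd t)            (even (Fin.suc .t)) refl = inj₂ (adj-odd-even t)
matched-collision {a} (even (Fin.suc t)) (odd .t)            refl = inj₂ (SqAdj-sym {suc a} (adj-odd-even t))
matched-collision     (even (Fin.suc t)) (even (Fin.suc .t)) refl = inj₁ refl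
matched-collision     (even Fin.zero)    (even Fin.zero)     refl = inj₁ refl
matched-collision     (even Fin.zero)    (leaf .Fin.zero)    refl = inj₂ (adj-u-leaf Fin.zero)
matched-collision {a} (leaf .Fin.zero)   (even Fin.zero)     refl =
  inj₂ (SqAdj-sym {suc a} (adj-u-leaf Fin.zero))
matched-collision     (leaf j)           (leaf .j)           refl = inj₁ refl

position-matched≤ : ∀ {a} (s : Slot a) → position (matched s) ≤ 2 * a
position-matched≤ {a} (odd t)            = ≤-trans (<⇒≤ (toℕ<n t)) (m≤m+n a _)
position-matched≤ {a} (even Fin.zero)    = position-leaf≤ {a} Fin.zero
position-matched≤ {a} (even (Fin.suc t)) = ≤-trans (<⇒≤ (toℕ<n t)) (m≤m+n a _)
position-matched≤     (leaf j)           = position-leaf≤ j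

module StablePartitionsOfSquid (a : ℕ) where

  private
    N : ℕ
    N = size (Squid (suc a))

  module Vertices = Enumeration {Slot a} {N} vertex
    (λ s → subst (vertex s <_) (sym (squid-size a)) (vertex<N s)) vertex-injective
    (λ i i<N → vertex-surjective a i (subst (i <_) (squid-size a) i<N))

  module Positions = Enumeration {Slot a} {N} position
    (λ s → subst (position s <_) (sym (squid-size a)) (position<N s)) position-injective
    (λ q q<N → position-surjective a q (subst (q <_) (squid-size a) q<N))

  slotOf : Fin N → Slot a
  slotOf = Inverse.from Vertices.enumeration

  slotOf-injective : ∀ {x y} → slotOf x ≡ slotOf y → x ≡ y
  slotOf-injective {x} {y} eq = trans (sym (Inverse.strictlyInverseˡ Vertices.enumeration x))
    (trans (cong (Inverse.to Vertices.enumeration) eq) (Inverse.strictlyInverseˡ Vertices.enumeration y))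

  Adj≡slot-adjacency : ∀ x y → Adj (Squid (suc a)) x y ≡ SqAdjℕ (suc a) (vertex (slotOf x)) (vertex (slotOf y))
  Adj≡slot-adjacency x y = sym (cong₂ (SqAdjℕ (suc a)) (Vertices.enumeration-from x) (Vertices.enumeration-from y))

  order : Permutation N N
  order = ↔-trans (↔-sym Vertices.enumeration) Positions.enumeration

  squid-realises : ∀ {μ} → IsPartition N μ → sum (take 1 μ) ≤ suc (2 * a) → sum (take 2 μ) < N →
                   HasStablePartitionOfType (Squid (suc a)) μ
  squid-realises {[]}                 (_ , _ , total) _ two<N = contradiction total (<⇒≢ two<N)
  squid-realises {_ ∷ []}             (_ , _ , total) _ two<N = contradiction total (<⇒≢ two<N)
  squid-realises {_ ∷ _ ∷ []}         (_ , _ , total) _ two<N = contradiction total (<⇒≢ two<N)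
  squid-realises {μ@(m₁ ∷ _ ∷ _ ∷ _)} (sorted , positive , total) first≤ _ =
    length μ , colouring , stable , ↭-reflexive sizes
    where
    colouring : Fin N → Fin (length μ)
    colouring = chunkMap μ total ∘ (order ⟨$⟩ʳ_)
    sizes : blockSizes colouring ≡ μ
    sizes = trans (blockSizes-permute (chunkMap μ total) order) (blockSizes-chunkMap μ total)
    same-chunk : ∀ {x y} → colouring x ≡ colouring y →
                 chunk μ (position (slotOf x)) ≡ chunk μ (position (slotOf y))
    same-chunk {x} {y} eq = begin
      chunk μ (position (slotOf x)) ≡⟨ cong (chunk μ) (Positions.toℕ-enumeration (slotOf x)) ⟨
      chunk μ (toℕ (order ⟨$⟩ʳ x))   ≡⟨ toℕ-chunkMap μ total _ ⟨
      toℕ (colouring x)             ≡⟨ cong toℕ eq ⟩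
      toℕ (colouring y)             ≡⟨ toℕ-chunkMap μ total _ ⟩
      chunk μ (toℕ (order ⟨$⟩ʳ y))   ≡⟨ cong (chunk μ) (Positions.toℕ-enumeration (slotOf y)) ⟩
      chunk μ (position (slotOf y)) ∎
      where open ≡-Reasoning
    apart⇒different : ∀ s s′ → Apart a (position s) (position s′) →
                      chunk μ (position s) ≢ chunk μ (position s′)
    apart⇒different s s′ apart = chunk-apart (sorted , positive , trans total (squid-size a))
      (subst (_≤ suc (2 * a)) (+-identityʳ m₁) first≤) apart (position<N s′)
    stable : IsStableMap (Squid (suc a)) colouring
    stable x y adj eq with edge-apart (slotOf x) (slotOf y) (subst id (Adj≡slot-adjacency x y) adj)
    ... | inj₁ apart = apart⇒different (slotOf x) (slotOf y) apart (same-chunk {x} {y} eq)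
    ... | inj₂ apart = apart⇒different (slotOf y) (slotOf x) apart (sym (same-chunk {x} {y} eq))

  no-2-colouring : ∀ (c : Fin N → Fin 2) → ¬ IsStableMap (Squid (suc a)) c
  no-2-colouring c stable =
    slot-stable (even (Fin.fromℕ a)) (even Fin.zero) adj-wrap (chain-constant a (colour ∘ even) alternation)
    where
    colour : Slot a → Fin 2
    colour = c ∘ Inverse.to Vertices.enumeration
    slot-stable : ∀ s s′ → SqAdjℕ (suc a) (vertex s) (vertex s′) → colour s ≢ colour s′
    slot-stable s s′ = stable _ _ ∘
      subst₂ (SqAdjℕ (suc a)) (sym (Vertices.toℕ-enumeration s)) (sym (Vertices.toℕ-enumeration s′))
    alternation : ∀ t → colour (even (Fin.inject₁ t)) ≡ colour (even (Fin.suc t))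
    alternation t = Fin2-≢-≢ (slot-stable (even (Fin.inject₁ t)) (odd t) (adj-even-odd t))
                             (slot-stable (odd t) (even (Fin.suc t)) (adj-odd-even t))

  cliqueOf : Fin N → Fin (suc (2 * a))
  cliqueOf x = fromℕ< (s≤s (position-matched≤ (slotOf x)))

  cliqueOf-cover : ∀ x y → cliqueOf x ≡ cliqueOf y → x ≡ y ⊎ Adj (Squid (suc a)) x y
  cliqueOf-cover x y eq with matched-collision (slotOf x) (slotOf y) (position-injective same-position)
    where
    same-position : position (matched (slotOf x)) ≡ position (matched (slotOf y))
    same-position = trans (sym (toℕ-fromℕ< _)) (trans (cong toℕ eq) (toℕ-fromℕ< _))
  ... | inj₁ same = inj₁ (slotOf-injective same)
  ... | inj₂ adj  = inj₂ (subst id (sym (Adj≡slot-adjacency x y)) adj)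

  squid-type-bounds : ∀ {λs} → IsPartition N λs → HasStablePartitionOfType (Squid (suc a)) λs →
                      sum (take 1 λs) ≤ suc (2 * a) × sum (take 2 λs) < N
  squid-type-bounds {λs} (_ , positive , total) (k , c , stable , sizes↭λs) =
    first≤ parts≤ , subst (sum (take 2 λs) <_) total (take2<sum three≤length positive)
    where
    parts≤ : All (_≤ suc (2 * a)) λs
    parts≤ = All-resp-↭ sizes↭λs
      (Allₚ.map⁺ (Allₚ.tabulate⁺ (fibre≤cliques (Squid (suc a)) cliqueOf cliqueOf-cover c stable)))
    three≤length : 3 ≤ length λs
    three≤length = subst (3 ≤_) (trans (sym length-sizes) (↭-length sizes↭λs))
                         (colours≥3 (Squid (suc a)) no-2-colouring c stable)
      where
      length-sizes : length (blockSizes c) ≡ k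
      length-sizes = trans (length-map _ (allFin k)) (length-tabulate id)
    first≤ : ∀ {b xs} → All (_≤ b) xs → sum (take 1 xs) ≤ b
    first≤ []                    = z≤n
    first≤ {xs = x ∷ _} (x≤b ∷ _) = subst (_≤ _) (sym (+-identityʳ x)) x≤b

theorem4p2 : (n : ℕ) → 3 ≤ n → Nice (Squid n)
theorem4p2 (suc a) _ μ λs μ-partition λ-partition μ⊴λ λ-realised =
  squid-realises μ-partition (≤-trans (μ⊴λ 1) λ₁≤) (≤-<-trans (μ⊴λ 2) λ₁+λ₂<)
  where
  open StablePartitionsOfSquid a
  λ₁≤ : sum (take 1 λs) ≤ suc (2 * a)
  λ₁≤ = proj₁ (squid-type-bounds λ-partition λ-realised)
  λ₁+λ₂< : sum (take 2 λs) < size (Squid (suc a))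
  λ₁+λ₂< = proj₂ (squid-type-bounds λ-partition λ-realised)
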